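{- Let $\mathcal{G}=(V_\mathcal{G},E^+_\mathcal{G},E^-_\mathcal{G},L_\mathcal{G})$ be a signed graph with $V_\mathcal{G}=[n]$. If $\omega$ is an even (respectively, odd) full cyclic permutation ordering of $\mathcal{G}$, then $\varphi(\omega)$ is a full cyclic permutation ordering of $\bar{\mathcal{G}}$ and $|L_\mathcal{G}|$ is even (respectively, odd).
   Context: $[n]=\{1,\dots,n\}$, $I_n=\{ -n,\dots,-1,1,\dots,n\}$, $\mathfrak{H}_n=\{\eta\in\mathfrak{S}_{I_n}:\eta(-i)=-\eta(i)\ \forall i\in I_n\}$. For distinct $i,j\in[n]$: $(i\ j)$ swaps $i\leftrightarrow j$, $-i\leftrightarrow -j$; $(i\ { -j})$ sends $i\mapsto -j$, $j\mapsto -i$ (and correspondingly on negatives); for $i\in[n]$, $(i\ { -i})$ swaps $i\leftrightarrow -i$; each fixes everything else. $\eta\in\mathfrak{H}_n$ is an even (resp. odd) full cyclic permutation if there are an ordering $i_1,\dots,i_n$ of $[n]$ and signs $\epsilon_k\in\{\pm1\}$ with $\eta(i_k)=\epsilon_k i_{k+1}$ (indices mod $n$) and $\epsilon_1\cdots\epsilon_n=+1$ (resp. $-1$). A signed graph is $\mathcal{G}=(V_\mathcal{G},E^+_\mathcal{G},E^-_\mathcal{G},L_\mathcal{G})$ with $V_\mathcal{G}=[n]$, $E^\pm_\mathcal{G}$ sets of 2-element subsets of $[n]$, $L_\mathcal{G}\subseteq[n]$ (loops); $E_\mathcal{G}=E^+_\mathcal{G}\sqcup E^-_\mathcal{G}\sqcup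 L_\mathcal{G}$. Set $\tau_e=(i\ j)$, $(i\ { -j})$, $(i\ { -i})$ for $e=\{i,j\}\in E^+_\mathcal{G}$, $e=\{i,j\}\in E^-_\mathcal{G}$, $e=i\in L_\mathcal{G}$ respectively. For an edge ordering (linear order) $\omega=(e_1,\dots,e_m)$ of $E_\mathcal{G}$, $\pi_\omega=\tau_{e_m}\cdots\tau_{e_1}$; $\omega$ is an even (resp. odd) full cyclic permutation ordering if $\pi_\omega$ is an even (resp. odd) full cyclic permutation. $\bar{\mathcal{G}}$ is the unsigned multigraph on $[n]$ with edges $E^+_\mathcal{G}\sqcup E^-_\mathcal{G}$, and $\varphi(\omega)$ is the edge ordering of $\bar{\mathcal{G}}$ obtained from $\omega$ by deleting loops. An edge ordering $(f_1,\dots,f_k)$ of $\bar{\mathcal{G}}$ with $f_t=\{a_t,b_t\}$ is a full cyclic permutation ordering if $(a_k\ b_k)\cdots(a_1\ b_1)\in\mathfrak{S}_n$ is a cycle of length $n$. -}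

module Defs where

open import Data.Nat using (ℕ; zero; suc)
open import Data.Nat.Properties using () renaming (_≟_ to _≟ℕ_)
open import Data.Bool using (Bool; true; false; _xor_; if_then_else_)
open import Data.Fin using (Fin; toℕ; lower₁; _<_)
open import Data.Fin.Properties using (_≟_)
open import Data.Product using (_×_; _,_; Σ; ∃)
open import Data.List using (List; []; _∷_; foldr)
open import Data.List.Membership.Propositional using (_∈_)
open import Data.List.Relation.Unary.Unique.Propositional using (Unique)
open import Data.Fin.Subset using (Subset)
open import Function.Definitions using (Injective)
open import Function.Bundles using (_⇔_)
open import Relation.Binary.PropositionalEquality using (_≡_; _≢_)
open import Relation.Nullary using (yes; no; ¬_)

cyc : ∀ {n} → Fin n → Fin n
cyc {suc m} i with m ≟ℕ toℕ i
... | yes _ = Fin.zero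
... | no ne = Fin.suc (lower₁ i ne)

-- Signed permutations of I_n = {±1,…,±n}.
-- An element η of 𝔥_n is determined by its values on positive elements:
-- η i = (j , s) means η(i) = j if s = false, η(i) = -j if s = true;
-- then η(-i) = -η(i).

SignedMap : ℕ → Set
SignedMap n = Fin n → Fin n × Bool

idˢ : ∀ {n} → SignedMap n
idˢ i = i , false

-- (f ∘ˢ g) = f after g, using η(-j) = -η(j)
_∘ˢ_ : ∀ {n} → SignedMap n → SignedMap n → SignedMap n
(f ∘ˢ g) x with g x
... | y , s with f y
...   | z , t = z , (s xor t)

-- η is a full cyclic permutation with sign parity `neg`:
-- there are an ordering i_1..i_n of [n] (σ injective) and signs ε_k
-- (true = -1) with η(i_k) = ε_k i_{k+1} (indices mod n), and
-- ε_1 ⋯ ε_n = -1 iff neg = true.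
xorAll : ∀ {n} → (Fin n → Bool) → Bool
xorAll {zero} ε = false
xorAll {suc n} ε = ε Fin.zero xor xorAll (λ k → ε (Fin.suc k))

SignedFullCyclic : ∀ {n} → Bool → SignedMap n → Set
SignedFullCyclic {n} neg η =
  Σ (Fin n → Fin n) λ σ → Σ (Fin n → Bool) λ ε →
    Injective _≡_ _≡_ σ ×
    (∀ k → η (σ k) ≡ (σ (cyc k) , ε k)) ×
    xorAll ε ≡ neg

EvenFullCyclic OddFullCyclic : ∀ {n} → SignedMap n → Set
EvenFullCyclic = SignedFullCyclic false
OddFullCyclic  = SignedFullCyclic true

-- Signed graphs on [n].  A 2-element subset {i,j} is encoded by the
-- ordered pair with i < j; only those entries of Epos/Eneg matter.

record SignedGraph (n : ℕ) : Set where
  field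
    Epos : Fin n → Fin n → Bool
    Eneg : Fin n → Fin n → Bool
    L    : Subset n
open SignedGraph public

data SEdge (n : ℕ) : Set where
  pos  : (i j : Fin n) → i < j → SEdge n
  neg  : (i j : Fin n) → i < j → SEdge n
  loop : (i : Fin n) → SEdge n

_∈E_ : ∀ {n} → SEdge n → SignedGraph n → Set
pos i j _ ∈E G = Epos G i j ≡ true
neg i j _ ∈E G = Eneg G i j ≡ true
loop i    ∈E G = i Data.Fin.Subset.∈ L G

IsEdgeOrdering : ∀ {n} → SignedGraph n → List (SEdge n) → Set
IsEdgeOrdering G ω = Unique ω × (∀ e → (e ∈ ω) ⇔ (e ∈E G))

τ : ∀ {n} → SEdge n → SignedMap n
τ (pos i j _) x with x ≟ i | x ≟ j
... | yes _ | _     = j , false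
... | no _  | yes _ = i , false
... | no _  | no _  = x , false
τ (neg i j _) x with x ≟ i | x ≟ j
... | yes _ | _     = j , true
... | no _  | yes _ = i , true
... | no _  | no _  = x , false
τ (loop i) x with x ≟ i
... | yes _ = i , true
... | no _  = x , false

-- π_ω = τ_{e_m} ⋯ τ_{e_1}  (e_1 applied first)
πˢ : ∀ {n} → List (SEdge n) → SignedMap n
πˢ [] = idˢ
πˢ (e ∷ ω) = πˢ ω ∘ˢ τ e

UEdge : ℕ → Set
UEdge n = Fin n × Fin n

φ : ∀ {n} → List (SEdge n) → List (UEdge n)
φ [] = []
φ (pos i j _ ∷ ω) = (i , j) ∷ φ ω
φ (neg i j _ ∷ ω) = (i , j) ∷ φ ω
φ (loop i ∷ ω) = φ ω

swap : ∀ {n} → Fin n → Fin n → Fin n → Fin n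
swap a b x with x ≟ a | x ≟ b
... | yes _ | _     = b
... | no _  | yes _ = a
... | no _  | no _  = x

-- (a_k b_k) ⋯ (a_1 b_1)
πᵘ : ∀ {n} → List (UEdge n) → Fin n → Fin n
πᵘ [] x = x
πᵘ ((a , b) ∷ ω) x = πᵘ ω (swap a b x)

IsFullCycle : ∀ {n} → (Fin n → Fin n) → Set
IsFullCycle {n} p =
  Σ (Fin n → Fin n) λ σ → Injective _≡_ _≡_ σ × (∀ k → p (σ k) ≡ σ (cyc k))

FullCyclicOrderingᵘ : ∀ {n} → List (UEdge n) → Set
FullCyclicOrderingᵘ ω = IsFullCycle (πᵘ ω)

{-# OPTIONS --safe #-}
module Submission where

-- Write a signed map η as its underlying permutation |η| together with the signs of
-- η(1), …, η(n), and let sign η be the product of those signs.  Forgetting signs turns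
-- π_ω into π_φ(ω), since a loop acts trivially on [n]; and sign is multiplicative, with
-- sign τ_e = -1 exactly for loops, so sign π_ω = (-1)^|L|.  If η(i_k) = ε_k i_{k+1} is a
-- full cyclic permutation, |η| is the n-cycle i_1 ↦ ⋯ ↦ i_n ↦ i_1 and, the i_k running
-- through [n], sign η = ε_1 ⋯ ε_n.  Signs are Booleans (true = -1), so products are
-- xor-sums over Fin n, computed in the xor monoid.

open import Defs
open import Algebra.Bundles using (CommutativeMonoid; CommutativeRing)
import Algebra.Properties.CommutativeMonoid.Sum as CommutativeMonoidSum
open import Data.Bool using (Bool; true; false; not; _xor_)
open import Data.Bool.Properties using (xor-∧-commutativeRing; not-involutive)
open import Data.Fin using (Fin; punchOut)
open import Data.Fin.Properties using (_≟_; any?; punchOut-injective; injective⇒≤; <⇒≢)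
open import Data.Fin.Subset using (Subset; ∣_∣)
open import Data.List using (List; []; _∷_; foldr)
open import Data.List.Membership.Propositional using (_∈_; _∉_)
open import Data.List.Relation.Unary.Any using (here; there)
import Data.List.Relation.Unary.All as All
open import Data.List.Relation.Unary.All.Properties using (All¬⇒¬Any)
open import Data.List.Relation.Unary.AllPairs using (_∷_)
open import Data.List.Relation.Unary.Unique.Propositional using (Unique)
open import Data.Nat using (ℕ; zero; suc; _*_)
open import Data.Nat.Divisibility using (_∣_; divides)
open import Data.Nat.Properties using (1+n≰n)
open import Data.Product using (_×_; _,_; proj₁; proj₂; ∃)
open import Data.Vec using ([]; _∷_; lookup)
open import Data.Vec.Properties using (lookup⇒[]=; []=⇒lookup)
open import Function using (_∘_)
open import Function.Bundles using (Equivalence; mk↔ₛ′)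
open import Function.Definitions using (Injective)
open import Relation.Binary.PropositionalEquality
open import Relation.Nullary using (yes; no; ¬_; does)
open import Relation.Nullary.Decidable using (dec-true; dec-false)
open import Relation.Nullary.Negation using (contradiction)

oddᵇ : ℕ → Bool
oddᵇ zero    = false
oddᵇ (suc n) = not (oddᵇ n)

2∣⇒oddᵇ≡false : ∀ {n} → 2 ∣ n → oddᵇ n ≡ false
2∣⇒oddᵇ≡false (divides q refl) = oddᵇ-even q
  where
  oddᵇ-even : ∀ q → oddᵇ (q * 2) ≡ false
  oddᵇ-even zero    = refl
  oddᵇ-even (suc q) = trans (not-involutive _) (oddᵇ-even q)

oddᵇ≡false⇒2∣ : ∀ n → oddᵇ n ≡ false → 2 ∣ n
oddᵇ≡false⇒2∣ zero          _ = divides 0 refl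
oddᵇ≡false⇒2∣ (suc (suc n)) e with oddᵇ≡false⇒2∣ n (trans (sym (not-involutive _)) e)
... | divides q refl = divides (suc q) refl

injective⇒surjective : ∀ {n} {σ : Fin n → Fin n} → Injective _≡_ _≡_ σ → ∀ y → ∃ λ x → σ x ≡ y
injective⇒surjective {suc n} {σ} σ-inj y with any? (λ x → σ x ≟ y)
... | yes hit = hit
... | no  miss = contradiction (injective⇒≤ σ-avoiding-y-inj) 1+n≰n
  where
  σ-avoiding-y : Fin (suc n) → Fin n
  σ-avoiding-y x = punchOut {i = y} {j = σ x} (λ e → miss (x , sym e))
  σ-avoiding-y-inj : Injective _≡_ _≡_ σ-avoiding-y
  σ-avoiding-y-inj {a} {b} =
    σ-inj ∘ punchOut-injective (λ e → miss (a , sym e)) (λ e → miss (b , sym e))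

xor-commutativeMonoid : CommutativeMonoid _ _
xor-commutativeMonoid = CommutativeRing.+-commutativeMonoid xor-∧-commutativeRing

module ⊕ = CommutativeMonoidSum xor-commutativeMonoid

xorAll≡sum : ∀ {n} (f : Fin n → Bool) → xorAll f ≡ ⊕.sum f
xorAll≡sum {zero}  f = refl
xorAll≡sum {suc n} f = cong (f Fin.zero xor_) (xorAll≡sum (f ∘ Fin.suc))

xorAll-cong : ∀ {n} {f g : Fin n → Bool} → f ≗ g → xorAll f ≡ xorAll g
xorAll-cong {f = f} {g} f≗g = begin
  xorAll f  ≡⟨ xorAll≡sum f ⟩
  ⊕.sum f   ≡⟨ ⊕.sum-cong-≗ f≗g ⟩
  ⊕.sum g   ≡⟨ xorAll≡sum g ⟨
  xorAll g  ∎
  where open ≡-Reasoning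

xorAll-false : ∀ n → xorAll {n} (λ _ → false) ≡ false
xorAll-false n = trans (xorAll≡sum {n} (λ _ → false)) (⊕.sum-replicate-zero n)

xorAll-distrib-xor : ∀ {n} (f g : Fin n → Bool) →
  xorAll (λ x → f x xor g x) ≡ xorAll f xor xorAll g
xorAll-distrib-xor f g = begin
  xorAll (λ x → f x xor g x)  ≡⟨ xorAll≡sum (λ x → f x xor g x) ⟩
  ⊕.sum (λ x → f x xor g x)   ≡⟨ ⊕.∑-distrib-+ f g ⟩
  ⊕.sum f xor ⊕.sum g         ≡⟨ cong₂ _xor_ (xorAll≡sum f) (xorAll≡sum g) ⟨
  xorAll f xor xorAll g       ∎
  where open ≡-Reasoning

xorAll-∘-injective : ∀ {n} {σ : Fin n → Fin n} → Injective _≡_ _≡_ σ →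
  (f : Fin n → Bool) → xorAll (f ∘ σ) ≡ xorAll f
xorAll-∘-injective {σ = σ} σ-inj f = begin
  xorAll (f ∘ σ)  ≡⟨ xorAll≡sum (f ∘ σ) ⟩
  ⊕.sum (f ∘ σ)   ≡⟨ ⊕.sum-permute f (mk↔ₛ′ σ σ⁻¹ σ∘σ⁻¹ σ⁻¹∘σ) ⟨
  ⊕.sum f         ≡⟨ xorAll≡sum f ⟨
  xorAll f        ∎
  where
  open ≡-Reasoning
  σ⁻¹ : Fin _ → Fin _
  σ⁻¹ = proj₁ ∘ injective⇒surjective σ-inj
  σ∘σ⁻¹ : ∀ y → σ (σ⁻¹ y) ≡ y
  σ∘σ⁻¹ = proj₂ ∘ injective⇒surjective σ-inj
  σ⁻¹∘σ : ∀ x → σ⁻¹ (σ x) ≡ x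
  σ⁻¹∘σ x = σ-inj (σ∘σ⁻¹ (σ x))

-- does (suc x ≟ suc i) computes to does (x ≟ i), so no case analysis on x is needed.
xorAll-indicator : ∀ {n} (i : Fin n) → xorAll (λ x → does (x ≟ i)) ≡ true
xorAll-indicator {suc n} Fin.zero     = cong not (xorAll-false n)
xorAll-indicator         (Fin.suc i) = xorAll-indicator i

xorAll-lookup : ∀ {n} (L : Subset n) → xorAll (lookup L) ≡ oddᵇ ∣ L ∣
xorAll-lookup []          = refl
xorAll-lookup (true  ∷ L) = cong not (xorAll-lookup L)
xorAll-lookup (false ∷ L) = xorAll-lookup L

underlying : ∀ {n} → SignedMap n → Fin n → Fin n
underlying η = proj₁ ∘ η

sign : ∀ {n} → SignedMap n → Bool
sign η = xorAll (proj₂ ∘ η)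

∘ˢ-unfold : ∀ {n} (f g : SignedMap n) x →
  (f ∘ˢ g) x ≡ (underlying f (underlying g x) , proj₂ (g x) xor proj₂ (f (underlying g x)))
∘ˢ-unfold f g x with g x
... | y , s with f y
...   | z , t = refl

sign-∘ˢ : ∀ {n} (f g : SignedMap n) → Injective _≡_ _≡_ (underlying g) →
  sign (f ∘ˢ g) ≡ sign g xor sign f
sign-∘ˢ f g g-inj = begin
  sign (f ∘ˢ g)
    ≡⟨ xorAll-cong (cong proj₂ ∘ ∘ˢ-unfold f g) ⟩
  xorAll (λ x → proj₂ (g x) xor proj₂ (f (underlying g x)))
    ≡⟨ xorAll-distrib-xor (proj₂ ∘ g) (proj₂ ∘ f ∘ underlying g) ⟩
  sign g xor xorAll (proj₂ ∘ f ∘ underlying g)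
    ≡⟨ cong (sign g xor_) (xorAll-∘-injective g-inj (proj₂ ∘ f)) ⟩
  sign g xor sign f
    ∎
  where open ≡-Reasoning

IsFullCycle-resp-≗ : ∀ {n} {p q : Fin n → Fin n} → p ≗ q → IsFullCycle p → IsFullCycle q
IsFullCycle-resp-≗ p≗q (σ , σ-inj , cycles) = σ , σ-inj , λ k → trans (sym (p≗q (σ k))) (cycles k)

signedFullCyclic⇒fullCycle : ∀ {n} {b} (η : SignedMap n) → SignedFullCyclic b η → IsFullCycle (underlying η)
signedFullCyclic⇒fullCycle η (σ , ε , σ-inj , η∘σ , _) = σ , σ-inj , cong proj₁ ∘ η∘σ

signedFullCyclic⇒sign : ∀ {n} {b} (η : SignedMap n) → SignedFullCyclic b η → sign η ≡ b
signedFullCyclic⇒sign {b = b} η (σ , ε , σ-inj , η∘σ , ∏ε≡b) = begin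
  sign η                   ≡⟨ xorAll-∘-injective σ-inj (proj₂ ∘ η) ⟨
  xorAll (proj₂ ∘ η ∘ σ)   ≡⟨ xorAll-cong (cong proj₂ ∘ η∘σ) ⟩
  xorAll ε                 ≡⟨ ∏ε≡b ⟩
  b                        ∎
  where open ≡-Reasoning

swap-left : ∀ {n} (a b : Fin n) → swap a b a ≡ b
swap-left a b with a ≟ a
... | yes _  = refl
... | no a≢a = contradiction refl a≢a

swap-right : ∀ {n} (a b : Fin n) → swap a b b ≡ a
swap-right a b with b ≟ a | b ≟ b
... | yes b≡a | _      = b≡a
... | no _    | yes _  = refl
... | no _    | no b≢b = contradiction refl b≢b

swap-involutive : ∀ {n} (a b x : Fin n) → swap a b (swap a b x) ≡ x
swap-involutive a b x with x ≟ a | x ≟ b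
... | yes refl | _        = swap-right x b
... | no _     | yes refl = swap-left a x
... | no x≢a   | no x≢b with x ≟ a | x ≟ b
...   | yes x≡a | _       = contradiction x≡a x≢a
...   | no _    | yes x≡b = contradiction x≡b x≢b
...   | no _    | no _    = refl

τᵘ : ∀ {n} → SEdge n → Fin n → Fin n
τᵘ (pos i j _) = swap i j
τᵘ (neg i j _) = swap i j
τᵘ (loop i) x  = x

underlying-τ : ∀ {n} (e : SEdge n) x → underlying (τ e) x ≡ τᵘ e x
underlying-τ (pos i j _) x with x ≟ i | x ≟ j
... | yes _ | _     = refl
... | no _  | yes _ = refl
... | no _  | no _  = refl
underlying-τ (neg i j _) x with x ≟ i | x ≟ j
... | yes _ | _     = refl
... | no _  | yes _ = refl
... | no _  | no _  = refl
underlying-τ (loop i) x with x ≟ i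
... | yes x≡i = sym x≡i
... | no _    = refl

τᵘ-involutive : ∀ {n} (e : SEdge n) x → τᵘ e (τᵘ e x) ≡ x
τᵘ-involutive (pos i j _) = swap-involutive i j
τᵘ-involutive (neg i j _) = swap-involutive i j
τᵘ-involutive (loop i) x  = refl

underlying-τ-injective : ∀ {n} (e : SEdge n) → Injective _≡_ _≡_ (underlying (τ e))
underlying-τ-injective e {x} {y} τx≡τy = begin
  x                 ≡⟨ τᵘ-involutive e x ⟨
  τᵘ e (τᵘ e x)     ≡⟨ cong (τᵘ e) (trans (sym (underlying-τ e x)) (trans τx≡τy (underlying-τ e y))) ⟩
  τᵘ e (τᵘ e y)     ≡⟨ τᵘ-involutive e y ⟩
  y                 ∎
  where open ≡-Reasoning

isLoopAt : ∀ {n} → Fin n → SEdge n → Bool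
isLoopAt i (loop j) = does (i ≟ j)
isLoopAt i _        = false

sign-τ : ∀ {n} (e : SEdge n) → sign (τ e) ≡ xorAll (λ i → isLoopAt i e)
sign-τ (pos i j i<j) = xorAll-cong sign-τ-pos
  where
  sign-τ-pos : ∀ x → proj₂ (τ (pos i j i<j) x) ≡ false
  sign-τ-pos x with x ≟ i | x ≟ j
  ... | yes _ | _     = refl
  ... | no _  | yes _ = refl
  ... | no _  | no _  = refl
sign-τ {n} (neg i j i<j) = begin
  sign (τ (neg i j i<j))
    ≡⟨ xorAll-cong sign-τ-neg ⟩
  xorAll (λ x → does (x ≟ i) xor does (x ≟ j))
    ≡⟨ xorAll-distrib-xor (λ x → does (x ≟ i)) (λ x → does (x ≟ j)) ⟩
  xorAll (λ x → does (x ≟ i)) xor xorAll (λ x → does (x ≟ j))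
    ≡⟨ cong₂ _xor_ (xorAll-indicator i) (xorAll-indicator j) ⟩
  false
    ≡⟨ xorAll-false n ⟨
  xorAll {n} (λ _ → false)
    ∎
  where
  open ≡-Reasoning
  sign-τ-neg : ∀ x → proj₂ (τ (neg i j i<j) x) ≡ does (x ≟ i) xor does (x ≟ j)
  sign-τ-neg x with x ≟ i | x ≟ j
  ... | yes refl | yes refl = contradiction refl (<⇒≢ i<j)
  ... | yes _    | no _     = refl
  ... | no _     | yes _    = refl
  ... | no _     | no _     = refl
sign-τ (loop i) = xorAll-cong sign-τ-loop
  where
  sign-τ-loop : ∀ x → proj₂ (τ (loop i) x) ≡ does (x ≟ i)
  sign-τ-loop x with x ≟ i
  ... | yes _ = refl
  ... | no _  = refl

πᵘ-φ-∷ : ∀ {n} (e : SEdge n) (ω : List (SEdge n)) x → πᵘ (φ (e ∷ ω)) x ≡ πᵘ (φ ω) (τᵘ e x)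
πᵘ-φ-∷ (pos _ _ _) ω x = refl
πᵘ-φ-∷ (neg _ _ _) ω x = refl
πᵘ-φ-∷ (loop _)    ω x = refl

underlying-πˢ : ∀ {n} (ω : List (SEdge n)) x → underlying (πˢ ω) x ≡ πᵘ (φ ω) x
underlying-πˢ []      x = refl
underlying-πˢ (e ∷ ω) x = begin
  underlying (πˢ ω ∘ˢ τ e) x            ≡⟨ cong proj₁ (∘ˢ-unfold (πˢ ω) (τ e) x) ⟩
  underlying (πˢ ω) (underlying (τ e) x) ≡⟨ underlying-πˢ ω _ ⟩
  πᵘ (φ ω) (underlying (τ e) x)         ≡⟨ cong (πᵘ (φ ω)) (underlying-τ e x) ⟩
  πᵘ (φ ω) (τᵘ e x)                     ≡⟨ πᵘ-φ-∷ e ω x ⟨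
  πᵘ (φ (e ∷ ω)) x                      ∎
  where open ≡-Reasoning

loopsAt : ∀ {n} → Fin n → List (SEdge n) → Bool
loopsAt i = foldr (λ e b → isLoopAt i e xor b) false

sign-πˢ : ∀ {n} (ω : List (SEdge n)) → sign (πˢ ω) ≡ xorAll (λ i → loopsAt i ω)
sign-πˢ []      = refl
sign-πˢ (e ∷ ω) = begin
  sign (πˢ ω ∘ˢ τ e)
    ≡⟨ sign-∘ˢ (πˢ ω) (τ e) (underlying-τ-injective e) ⟩
  sign (τ e) xor sign (πˢ ω)
    ≡⟨ cong₂ _xor_ (sign-τ e) (sign-πˢ ω) ⟩
  xorAll (λ i → isLoopAt i e) xor xorAll (λ i → loopsAt i ω)
    ≡⟨ xorAll-distrib-xor (λ i → isLoopAt i e) (λ i → loopsAt i ω) ⟨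
  xorAll (λ i → loopsAt i (e ∷ ω))
    ∎
  where open ≡-Reasoning

isLoopAt-≢ : ∀ {n} {i : Fin n} {e} → loop i ≢ e → isLoopAt i e ≡ false
isLoopAt-≢ {e = pos _ _ _} _      = refl
isLoopAt-≢ {e = neg _ _ _} _      = refl
isLoopAt-≢ {i = i} {loop j} i≢j = dec-false (i ≟ j) (i≢j ∘ cong loop)

loopsAt-∉ : ∀ {n} {i : Fin n} {ω} → loop i ∉ ω → loopsAt i ω ≡ false
loopsAt-∉ {ω = []}    _   = refl
loopsAt-∉ {ω = e ∷ ω} i∉ = cong₂ _xor_ (isLoopAt-≢ (i∉ ∘ here)) (loopsAt-∉ (i∉ ∘ there))

loopsAt-∈ : ∀ {n} {i : Fin n} {ω} → Unique ω → loop i ∈ ω → loopsAt i ω ≡ true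
loopsAt-∈ {i = i} (i∉ω ∷ _) (here refl) =
  cong₂ _xor_ (dec-true (i ≟ i) refl) (loopsAt-∉ (All¬⇒¬Any i∉ω))
loopsAt-∈ (e∉ω ∷ ω-unique) (there i∈ω) =
  cong₂ _xor_ (isLoopAt-≢ (All.lookup e∉ω i∈ω ∘ sym)) (loopsAt-∈ ω-unique i∈ω)

loopsAt≡L : ∀ {n} (G : SignedGraph n) {ω} → IsEdgeOrdering G ω → ∀ i → loopsAt i ω ≡ lookup (L G) i
loopsAt≡L G (ω-unique , ω≡E) i with lookup (L G) i in i∈?L
... | true  = loopsAt-∈ ω-unique (Equivalence.from (ω≡E (loop i)) (lookup⇒[]= i (L G) i∈?L))
... | false = loopsAt-∉ λ i∈ω →
  contradiction (trans (sym i∈?L) ([]=⇒lookup (Equivalence.to (ω≡E (loop i)) i∈ω))) λ ()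

sign-πˢ≡oddᵇ∣L∣ : ∀ {n} (G : SignedGraph n) {ω} → IsEdgeOrdering G ω → sign (πˢ ω) ≡ oddᵇ ∣ L G ∣
sign-πˢ≡oddᵇ∣L∣ G {ω} ω-ordering = begin
  sign (πˢ ω)                  ≡⟨ sign-πˢ ω ⟩
  xorAll (λ i → loopsAt i ω)   ≡⟨ xorAll-cong (loopsAt≡L G ω-ordering) ⟩
  xorAll (lookup (L G))        ≡⟨ xorAll-lookup (L G) ⟩
  oddᵇ ∣ L G ∣                 ∎
  where open ≡-Reasoning

signedFullCyclic-πˢ : ∀ {n} (G : SignedGraph n) {ω} → IsEdgeOrdering G ω → ∀ {b} →
  SignedFullCyclic b (πˢ ω) → FullCyclicOrderingᵘ (φ ω) × oddᵇ ∣ L G ∣ ≡ b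
signedFullCyclic-πˢ G {ω} ω-ordering cyclic =
  IsFullCycle-resp-≗ (underlying-πˢ ω) (signedFullCyclic⇒fullCycle (πˢ ω) cyclic) ,
  trans (sym (sign-πˢ≡oddᵇ∣L∣ G ω-ordering)) (signedFullCyclic⇒sign (πˢ ω) cyclic)

proposition2p5 : (n : ℕ) (G : SignedGraph n) (ω : List (SEdge n)) →
    IsEdgeOrdering G ω →
    (EvenFullCyclic (πˢ ω) → FullCyclicOrderingᵘ (φ ω) × 2 ∣ ∣ L G ∣) ×
    (OddFullCyclic (πˢ ω) → FullCyclicOrderingᵘ (φ ω) × ¬ (2 ∣ ∣ L G ∣))
proposition2p5 n G ω ω-ordering = even , odd
  where
  even : EvenFullCyclic (πˢ ω) → FullCyclicOrderingᵘ (φ ω) × 2 ∣ ∣ L G ∣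
  even cyclic with full , parity ← signedFullCyclic-πˢ G ω-ordering cyclic =
    full , oddᵇ≡false⇒2∣ ∣ L G ∣ parity
  odd : OddFullCyclic (πˢ ω) → FullCyclicOrderingᵘ (φ ω) × ¬ (2 ∣ ∣ L G ∣)
  odd cyclic with full , parity ← signedFullCyclic-πˢ G ω-ordering cyclic =
    full , λ 2∣L → contradiction (trans (sym parity) (2∣⇒oddᵇ≡false 2∣L)) λ ()
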